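{- Let $G$ be a finite, simple, connected, claw-free graph with minimum degree $\delta(G) \ge 1$. Then $Z(G) \le \beta(G)$. Moreover, this bound is sharp: there exist connected claw-free graphs $G$ with $\delta(G)\ge 1$ for which $Z(G) = \beta(G)$.
   Context: A graph is claw-free if it contains no induced subgraph isomorphic to $K_{1,3}$. A vertex cover of $G$ is a set $C \subseteq V(G)$ such that every edge has at least one endpoint in $C$; $\beta(G)$ is the minimum cardinality of a vertex cover. Zero forcing process: starting from a set $B \subseteq V(G)$ of vertices colored blue (all others white), repeatedly, if a blue vertex has exactly one white neighbor, that neighbor is colored blue. $B$ is a zero forcing set if eventually all vertices become blue. $Z(G)$, the zero forcing number, is the minimum cardinality of a zero forcing set of $G$. -}

module Defs where

open import Data.Nat using (ℕ; _≤_)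
open import Data.Fin using (Fin)
open import Data.Fin.Subset using (Subset; _∈_; _∉_; ∣_∣)
open import Data.Bool using (Bool; true; false)
open import Data.Product using (Σ; ∃; _×_; _,_)
open import Data.Sum using (_⊎_)
open import Relation.Binary.PropositionalEquality using (_≡_; _≢_)
open import Relation.Nullary using (¬_)

record Graph (n : ℕ) : Set where
  field
    adj     : Fin n → Fin n → Bool
    symm    : ∀ u v → adj u v ≡ adj v u
    irrefl  : ∀ v → adj v v ≡ false

open Graph public

module _ {n : ℕ} (G : Graph n) where

  Adj : Fin n → Fin n → Set
  Adj u v = adj G u v ≡ true

  data Walk : Fin n → Fin n → Set where
    here : ∀ {v} → Walk v v
    step : ∀ {u w v} → Adj u w → Walk w v → Walk u v

  Connected : Set
  Connected = ∀ u v → Walk u v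

  MinDegreeAtLeast1 : Set
  MinDegreeAtLeast1 = ∀ v → ∃ λ u → Adj v u

  ClawFree : Set
  ClawFree = ∀ c a b d → Adj c a → Adj c b → Adj c d →
             a ≢ b → a ≢ d → b ≢ d →
             ¬ (¬ Adj a b × ¬ Adj a d × ¬ Adj b d)

  IsVertexCover : Subset n → Set
  IsVertexCover C = ∀ u v → Adj u v → u ∈ C ⊎ v ∈ C

  IsVertexCoverNumber : ℕ → Set
  IsVertexCoverNumber k =
    (Σ (Subset n) λ C → IsVertexCover C × ∣ C ∣ ≡ k) ×
    (∀ C → IsVertexCover C → k ≤ ∣ C ∣)

  -- Zero forcing: the set of vertices that eventually become blue when
  -- starting from B, i.e. the closure of B under the colour-change rule
  -- "a blue vertex u all of whose neighbours other than v are blue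
  --  forces its neighbour v".
  data Blue (B : Subset n) : Fin n → Set where
    initial : ∀ {v} → v ∈ B → Blue B v
    force   : ∀ {u v} → Blue B u → Adj u v →
              (∀ w → Adj u w → w ≢ v → Blue B w) → Blue B v

  IsZeroForcingSet : Subset n → Set
  IsZeroForcingSet B = ∀ v → Blue B v

  IsZeroForcingNumber : ℕ → Set
  IsZeroForcingNumber k =
    (Σ (Subset n) λ B → IsZeroForcingSet B × ∣ B ∣ ≡ k) ×
    (∀ B → IsZeroForcingSet B → k ≤ ∣ B ∣)

{-# OPTIONS --safe #-}

-- Let C be a minimum vertex cover, so that its complement is independent.  Start
-- with B = C and repeatedly swap a vertex c ∈ B for a neighbour x ∉ C of c that
-- is not yet known to turn blue.  All neighbours of x lie in C, so x can force c;
-- by claw-freeness c has at most one neighbour outside C besides x, so c can then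
-- force the rest of its neighbourhood.  The swaps keep ∣B∣ = ∣C∣ and strictly
-- enlarge the set of vertices known to turn blue, so they end with a zero forcing
-- set of size at most β(G).  Sharpness: Z(K₂) = β(K₂) = 1.
module Submission where

open import Defs
open import Data.Nat using (ℕ; suc; _+_; _≤_; _<_; z≤n; s≤s)
open import Data.Nat.Properties using (≤-trans; ≤-reflexive; +-suc; +-comm; +-monoʳ-≤; n≤1+n; module ≤-Reasoning)
open import Data.Nat.Induction using (<-wellFounded)
open import Data.Bool using (false; not)
open import Data.Product using (Σ; ∃; ∃₂; _×_; _,_; proj₁; proj₂)
open import Data.Sum using (inj₁; inj₂; [_,_])
open import Data.Empty using (⊥-elim)
open import Data.Fin using (Fin; zero; suc; _≟_)
open import Data.Fin.Subset using (Subset; _∈_; _∉_; _⊆_; _⊂_; ∣_∣; _∪_; _-_; ⁅_⁆; ∁; Nonempty; inside; outside)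
open import Data.Fin.Subset.Properties
open import Data.Vec using (_∷_; []; tabulate)
open import Data.Vec.Properties using ([]=⇒lookup; lookup⇒[]=; lookup∘tabulate)
open import Induction.WellFounded using (Acc; acc)
open import Relation.Binary.PropositionalEquality using (_≡_; _≢_; refl; sym; trans; cong; subst)
open import Relation.Nullary using (¬_; yes; no; ⌊_⌋)

∣p∪q∣≤∣p∣+∣q∣ : ∀ {n} (p q : Subset n) → ∣ p ∪ q ∣ ≤ ∣ p ∣ + ∣ q ∣
∣p∪q∣≤∣p∣+∣q∣ []            []            = z≤n
∣p∪q∣≤∣p∣+∣q∣ (outside ∷ p) (outside ∷ q) = ∣p∪q∣≤∣p∣+∣q∣ p q
∣p∪q∣≤∣p∣+∣q∣ (outside ∷ p) (inside  ∷ q) =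
  ≤-trans (s≤s (∣p∪q∣≤∣p∣+∣q∣ p q)) (≤-reflexive (sym (+-suc ∣ p ∣ ∣ q ∣)))
∣p∪q∣≤∣p∣+∣q∣ (inside  ∷ p) (outside ∷ q) = s≤s (∣p∪q∣≤∣p∣+∣q∣ p q)
∣p∪q∣≤∣p∣+∣q∣ (inside  ∷ p) (inside  ∷ q) =
  s≤s (≤-trans (∣p∪q∣≤∣p∣+∣q∣ p q) (+-monoʳ-≤ ∣ p ∣ (n≤1+n ∣ q ∣)))

∣p-x∪⁅y⁆∣≤∣p∣ : ∀ {n} {p : Subset n} {x} y → x ∈ p → ∣ (p - x) ∪ ⁅ y ⁆ ∣ ≤ ∣ p ∣
∣p-x∪⁅y⁆∣≤∣p∣ {p = p} {x} y x∈p = begin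
  ∣ (p - x) ∪ ⁅ y ⁆ ∣    ≤⟨ ∣p∪q∣≤∣p∣+∣q∣ (p - x) ⁅ y ⁆ ⟩
  ∣ p - x ∣ + ∣ ⁅ y ⁆ ∣  ≡⟨ cong (∣ p - x ∣ +_) (∣⁅x⁆∣≡1 y) ⟩
  ∣ p - x ∣ + 1          ≡⟨ +-comm ∣ p - x ∣ 1 ⟩
  suc ∣ p - x ∣          ≤⟨ x∈p⇒∣p-x∣<∣p∣ x∈p ⟩
  ∣ p ∣                  ∎
  where open ≤-Reasoning

x∈p⇒1≤∣p∣ : ∀ {n} {p : Subset n} {x} → x ∈ p → 1 ≤ ∣ p ∣
x∈p⇒1≤∣p∣ {p = p} {x} x∈p = ≤-trans (≤-reflexive (sym (∣⁅x⁆∣≡1 x)))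
  (p⊆q⇒∣p∣≤∣q∣ λ y∈⁅x⁆ → subst (_∈ p) (sym (x∈⁅y⁆⇒x≡y x y∈⁅x⁆)) x∈p)

saturate : ∀ {n} (P : Subset n → Set) →
           (∀ {D x} → P D → x ∉ D → ∃ λ D′ → P D′ × D ⊂ D′) →
           ∀ {D} → P D → ∃ λ D′ → P D′ × (∀ v → v ∈ D′)
saturate P enlarge {D} PD = go (<-wellFounded ∣ ∁ D ∣) PD
  where
  go : ∀ {D} → Acc _<_ ∣ ∁ D ∣ → P D → ∃ λ D′ → P D′ × (∀ v → v ∈ D′)
  go {D} (acc rec) PD with nonempty? (∁ D)
  ... | no ∁D-empty = D , PD , λ v → x∉∁p⇒x∈p (λ v∈∁D → ∁D-empty (v , v∈∁D))
  ... | yes (x , x∈∁D) with enlarge PD (x∈∁p⇒x∉p x∈∁D)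
  ...   | D′ , PD′ , D⊂D′ = go (rec (p⊂q⇒∣p∣<∣q∣ (p⊂q⇒∁p⊃∁q D⊂D′))) PD′

module _ {n} (G : Graph n) where

  Adj-sym : ∀ {u v} → Adj G u v → Adj G v u
  Adj-sym {u} {v} u~v = trans (symm G v u) u~v

  neighbourhood : Fin n → Subset n
  neighbourhood c = tabulate (adj G c)

  ∈-neighbourhood⁺ : ∀ {c w} → Adj G c w → w ∈ neighbourhood c
  ∈-neighbourhood⁺ {c} {w} c~w = lookup⇒[]= w _ (trans (lookup∘tabulate (adj G c) w) c~w)

  ∈-neighbourhood⁻ : ∀ {c w} → w ∈ neighbourhood c → Adj G c w
  ∈-neighbourhood⁻ {c} {w} w∈N = trans (sym (lookup∘tabulate (adj G c) w)) ([]=⇒lookup w∈N)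

  Blue-mono : ∀ {B B′} → (∀ {v} → v ∈ B → Blue G B′ v) → ∀ {v} → Blue G B v → Blue G B′ v
  Blue-mono B⊆Blue (initial v∈B)           = B⊆Blue v∈B
  Blue-mono B⊆Blue (force u-blue u~v rest) =
    force (Blue-mono B⊆Blue u-blue) u~v (λ w u~w w≢v → Blue-mono B⊆Blue (rest w u~w w≢v))

  Blue⇒Nonempty : ∀ {B v} → Blue G B v → Nonempty B
  Blue⇒Nonempty (initial v∈B)      = _ , v∈B
  Blue⇒Nonempty (force u-blue _ _) = Blue⇒Nonempty u-blue

  module _ {C : Subset n} (cover : IsVertexCover G C) where

    neighbour-∈-cover : ∀ {u v} → u ∉ C → Adj G u v → v ∈ C
    neighbour-∈-cover u∉C u~v with cover _ _ u~v
    ... | inj₁ u∈C = ⊥-elim (u∉C u∈C)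
    ... | inj₂ v∈C = v∈C

    ∉-cover-nonadjacent : ∀ {u v} → u ∉ C → v ∉ C → ¬ Adj G u v
    ∉-cover-nonadjacent u∉C v∉C u~v = v∉C (neighbour-∈-cover u∉C u~v)

    claw-free⇒two-neighbours-outside-cover :
      ClawFree G → ∀ {c x w w′} → Adj G c x → Adj G c w → Adj G c w′ →
      x ∉ C → w ∉ C → w′ ∉ C → w ≢ x → w′ ≢ w → w′ ≡ x
    claw-free⇒two-neighbours-outside-cover claw-free {c} {x} {w} {w′}
      c~x c~w c~w′ x∉C w∉C w′∉C w≢x w′≢w with w′ ≟ x
    ... | yes w′≡x = w′≡x
    ... | no  w′≢x = ⊥-elim (claw-free c x w w′ c~x c~w c~w′
          (λ x≡w → w≢x (sym x≡w)) (λ x≡w′ → w′≢x (sym x≡w′)) (λ w≡w′ → w′≢w (sym w≡w′))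
          ( ∉-cover-nonadjacent x∉C w∉C
          , ∉-cover-nonadjacent x∉C w′∉C
          , ∉-cover-nonadjacent w∉C w′∉C))

module CoverToZeroForcing {n} {G : Graph n} (claw-free : ClawFree G) (δ≥1 : MinDegreeAtLeast1 G)
                          {C : Subset n} (cover : IsVertexCover G C) where

  -- D is a set of vertices known to turn blue from B; every cover vertex already
  -- swapped out of B has its whole neighbourhood in D.
  record Progress (B D : Subset n) : Set where
    field
      D-blue    : ∀ {v} → v ∈ D → Blue G B v
      C⊆D       : C ⊆ D
      ∣B∣≤∣C∣   : ∣ B ∣ ≤ ∣ C ∣
      swapped-⊆ : ∀ {c w} → c ∈ C → c ∉ B → Adj G c w → w ∈ D

  open Progress

  start : Progress C C
  start = record
    { D-blue    = initial
    ; C⊆D       = λ v∈C → v∈C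
    ; ∣B∣≤∣C∣   = ≤-reflexive refl
    ; swapped-⊆ = λ c∈C c∉C _ → ⊥-elim (c∉C c∈C)
    }

  swap : ∀ {B D x} → Progress B D → x ∉ D →
         ∃₂ λ B′ D′ → Progress B′ D′ × D ⊂ D′
  swap {B} {D} {x} prog x∉D = B′ , D′ , prog′ , D⊂D′
    where
    x∉C : x ∉ C
    x∉C x∈C = x∉D (C⊆D prog x∈C)

    c : Fin n
    c = proj₁ (δ≥1 x)

    x~c : Adj G x c
    x~c = proj₂ (δ≥1 x)

    c∈C : c ∈ C
    c∈C = neighbour-∈-cover G cover x∉C x~c

    -- a neighbour of x outside B would have been swapped out, putting x into D
    neighbour-of-x-∈B : ∀ {d} → Adj G x d → d ∈ B
    neighbour-of-x-∈B {d} x~d with d ∈? B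
    ... | yes d∈B = d∈B
    ... | no  d∉B =
      ⊥-elim (x∉D (swapped-⊆ prog (neighbour-∈-cover G cover x∉C x~d) d∉B (Adj-sym G x~d)))

    B′ D′ : Subset n
    B′ = (B - c) ∪ ⁅ x ⁆
    D′ = D ∪ neighbourhood G c

    x∈B′ : x ∈ B′
    x∈B′ = q⊆p∪q (B - c) ⁅ x ⁆ (x∈⁅x⁆ x)

    kept : ∀ {v} → v ∈ B → v ≢ c → v ∈ B′
    kept v∈B v≢c = p⊆p∪q ⁅ x ⁆ (x∈p∧x≢y⇒x∈p-y v∈B v≢c)

    c-blue : Blue G B′ c
    c-blue = force (initial x∈B′) x~c
      (λ d x~d d≢c → initial (kept (neighbour-of-x-∈B x~d) d≢c))

    old-blue : ∀ {v} → Blue G B v → Blue G B′ v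
    old-blue = Blue-mono G B-blue
      where
      B-blue : ∀ {v} → v ∈ B → Blue G B′ v
      B-blue {v} v∈B with v ≟ c
      ... | yes refl = c-blue
      ... | no  v≢c  = initial (kept v∈B v≢c)

    C-blue : ∀ {v} → v ∈ C → Blue G B′ v
    C-blue v∈C = old-blue (D-blue prog (C⊆D prog v∈C))

    neighbour-of-c-blue : ∀ {w} → Adj G c w → Blue G B′ w
    neighbour-of-c-blue {w} c~w with w ≟ x | w ∈? C
    ... | yes refl | _       = initial x∈B′
    ... | no  _    | yes w∈C = C-blue w∈C
    ... | no  w≢x  | no  w∉C = force c-blue c~w other-blue
      where
      other-blue : ∀ w′ → Adj G c w′ → w′ ≢ w → Blue G B′ w′
      other-blue w′ c~w′ w′≢w with w′ ∈? C
      ... | yes w′∈C = C-blue w′∈C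
      ... | no  w′∉C with claw-free⇒two-neighbours-outside-cover G cover claw-free
                            (Adj-sym G x~c) c~w c~w′ x∉C w∉C w′∉C w≢x w′≢w
      ...   | refl = initial x∈B′

    prog′ : Progress B′ D′
    prog′ = record
      { D-blue    = D′-blue
      ; C⊆D       = λ v∈C → p⊆p∪q (neighbourhood G c) (C⊆D prog v∈C)
      ; ∣B∣≤∣C∣   = ≤-trans (∣p-x∪⁅y⁆∣≤∣p∣ x (neighbour-of-x-∈B x~c)) (∣B∣≤∣C∣ prog)
      ; swapped-⊆ = swapped′-⊆
      }
      where
      D′-blue : ∀ {v} → v ∈ D′ → Blue G B′ v
      D′-blue v∈D′ with x∈p∪q⁻ D (neighbourhood G c) v∈D′
      ... | inj₁ v∈D  = old-blue (D-blue prog v∈D)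
      ... | inj₂ v∈Nc = neighbour-of-c-blue (∈-neighbourhood⁻ G v∈Nc)

      swapped′-⊆ : ∀ {c′ w} → c′ ∈ C → c′ ∉ B′ → Adj G c′ w → w ∈ D′
      swapped′-⊆ {c′} c′∈C c′∉B′ c′~w with c′ ≟ c | c′ ∈? B
      ... | yes refl | _        = q⊆p∪q D (neighbourhood G c) (∈-neighbourhood⁺ G c′~w)
      ... | no  c′≢c | yes c′∈B = ⊥-elim (c′∉B′ (kept c′∈B c′≢c))
      ... | no  _    | no  c′∉B = p⊆p∪q (neighbourhood G c) (swapped-⊆ prog c′∈C c′∉B c′~w)

    D⊂D′ : D ⊂ D′
    D⊂D′ = p⊆p∪q (neighbourhood G c)
         , x , q⊆p∪q D (neighbourhood G c) (∈-neighbourhood⁺ G (Adj-sym G x~c)) , x∉D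

  zero-forcing-set : ∃ λ B → IsZeroForcingSet G B × ∣ B ∣ ≤ ∣ C ∣
  zero-forcing-set with saturate (λ D → ∃ λ B → Progress B D)
                                 (λ (_ , prog) x∉D → let B′ , D′ , prog′ , D⊂D′ = swap prog x∉D
                                                     in D′ , (B′ , prog′) , D⊂D′)
                                 (C , start)
  ... | D , (B , prog) , D-full = B , (λ v → D-blue prog (D-full v)) , ∣B∣≤∣C∣ prog

Z≤β : ∀ {n} (G : Graph n) → ClawFree G → MinDegreeAtLeast1 G →
      ∀ {z b} → IsZeroForcingNumber G z → IsVertexCoverNumber G b → z ≤ b
Z≤β G claw-free δ≥1 (_ , z-min) ((C , cover , refl) , _)
  with CoverToZeroForcing.zero-forcing-set claw-free δ≥1 cover
... | B , zero-forcing , ∣B∣≤∣C∣ = ≤-trans (z-min B zero-forcing) ∣B∣≤∣C∣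

complete : ∀ n → Graph n
complete n = record { adj = λ u v → not ⌊ u ≟ v ⌋ ; symm = symm′ ; irrefl = irrefl′ }
  where
  symm′ : ∀ u v → not ⌊ u ≟ v ⌋ ≡ not ⌊ v ≟ u ⌋
  symm′ u v with u ≟ v | v ≟ u
  ... | yes _    | yes _   = refl
  ... | no  _    | no  _   = refl
  ... | yes refl | no  v≢v = ⊥-elim (v≢v refl)
  ... | no  u≢u  | yes refl = ⊥-elim (u≢u refl)

  irrefl′ : ∀ v → not ⌊ v ≟ v ⌋ ≡ false
  irrefl′ v with v ≟ v
  ... | yes _   = refl
  ... | no  v≢v = ⊥-elim (v≢v refl)

complete-adj : ∀ {n} {u v : Fin n} → u ≢ v → Adj (complete n) u v
complete-adj {u = u} {v} u≢v with u ≟ v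
... | yes u≡v = ⊥-elim (u≢v u≡v)
... | no  _   = refl

complete-connected : ∀ n → Connected (complete n)
complete-connected n u v with u ≟ v
... | yes refl = here
... | no  u≢v  = step (complete-adj u≢v) here

complete-claw-free : ∀ n → ClawFree (complete n)
complete-claw-free n _ _ _ _ _ _ _ a≢b _ _ (a≁b , _) = a≁b (complete-adj a≢b)

complete-δ≥1 : ∀ n → MinDegreeAtLeast1 (complete (suc (suc n)))
complete-δ≥1 n zero    = suc zero , refl
complete-δ≥1 n (suc v) = zero , refl

K₂ : Graph 2
K₂ = complete 2

Z[K₂]≡1 : IsZeroForcingNumber K₂ 1
Z[K₂]≡1 = (⁅ zero ⁆ , zero-forcing , refl)
        , λ B zero-forcing-B → let _ , x∈B = Blue⇒Nonempty K₂ (zero-forcing-B zero) in x∈p⇒1≤∣p∣ x∈B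
  where
  zero-forcing : IsZeroForcingSet K₂ ⁅ zero ⁆
  zero-forcing zero       = initial (x∈⁅x⁆ zero)
  zero-forcing (suc zero) = force (initial (x∈⁅x⁆ zero)) refl only-neighbour
    where
    only-neighbour : ∀ w → Adj K₂ zero w → w ≢ suc zero → Blue K₂ ⁅ zero ⁆ w
    only-neighbour zero       ()
    only-neighbour (suc zero) _  1≢1 = ⊥-elim (1≢1 refl)

β[K₂]≡1 : IsVertexCoverNumber K₂ 1
β[K₂]≡1 = (⁅ zero ⁆ , cover , refl)
        , λ C cover-C → [ x∈p⇒1≤∣p∣ , x∈p⇒1≤∣p∣ ] (cover-C zero (suc zero) refl)
  where
  cover : IsVertexCover K₂ ⁅ zero ⁆
  cover zero       _          _  = inj₁ (x∈⁅x⁆ zero)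
  cover (suc zero) zero       _  = inj₂ (x∈⁅x⁆ zero)
  cover (suc zero) (suc zero) ()

theorem1 :
    ((n : ℕ) (G : Graph n) → Connected G → ClawFree G → MinDegreeAtLeast1 G →
      ∀ z b → IsZeroForcingNumber G z → IsVertexCoverNumber G b → z ≤ b)
    ×
    (Σ ℕ λ n → Σ (Graph n) λ G →
      Connected G × ClawFree G × MinDegreeAtLeast1 G ×
      Σ ℕ λ k → IsZeroForcingNumber G k × IsVertexCoverNumber G k)
theorem1 =
    (λ n G _ claw-free δ≥1 z b → Z≤β G claw-free δ≥1)
  , (2 , K₂ , complete-connected 2 , complete-claw-free 2 , complete-δ≥1 0 , 1 , Z[K₂]≡1 , β[K₂]≡1)
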